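{- Let $m\ge1$, $a\in\{0,1\}^{m+1}$, $n\ge1$, and indices $1\le i<j\le n-m$; set $\Delta=j-i$. Then $\varphi_i^{(a)}\circ\varphi_j^{(a)}=\varphi_j^{(a)}\circ\varphi_i^{(a)}$ as maps on $\{0,1\}^n$ if and only if either $\Delta\ge m+1$ (i.e. the lines of action $\{i,\dots,i+m\}$ and $\{j,\dots,j+m\}$ are disjoint), or $\Delta\le m$ and $$a_{[1,\,m+1-\Delta]}\notin\{a_{[\Delta+1,\,m+1]},\ \neg a_{[\Delta+1,\,m+1]}\}.$$
   Context: Binary words are elements of $\{0,1\}^n$; $\neg$ flips every letter; $u_{[k,l]}=(u_k,\dots,u_l)$. For a keyword $a\in\{0,1\}^{m+1}$ and $i\in\{1,\dots,n\}$, the simple map $\varphi_i^{(a)}:\{0,1\}^n\to\{0,1\}^n$ negates the letters of $u$ in positions $i,\dots,i+m$ if $i+m\le n$ and $u_{[i,i+m]}\in\{a,\neg a\}$, and otherwise returns $u$ unchanged. The set $\{i,\dots,i+m\}$ is called the line of action of $\varphi_i^{(a)}$. -}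

module Defs where

open import Data.Bool using (Bool; true; false; not; if_then_else_; _∧_)
open import Data.Nat using (ℕ; zero; suc; _+_; _∸_; _≤_; _≤ᵇ_)
open import Data.List using (List; take; drop)
open import Data.List.Properties using (≡-dec)
open import Data.Bool.Properties using () renaming (_≟_ to _≟ᵇ_)
open import Data.Vec using (Vec; toList; map; tabulate; lookup)
open import Data.Fin using (Fin; toℕ)
open import Relation.Nullary using (Dec; yes; no; ¬_)
open import Relation.Binary.PropositionalEquality using (_≡_)

Word : ℕ → Set
Word n = Vec Bool n

neg : ∀ {n} → Word n → Word n
neg = map not

negL : List Bool → List Bool
negL = Data.List.map not

-- Subword u_[k,l] (1-based, inclusive), as a list of letters.
-- (Only used with 1 ≤ k ≤ l+1, l ≤ length.)
sub : ∀ {n} → Word n → ℕ → ℕ → List Bool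
sub u k l = take (suc l ∸ k) (drop (k ∸ 1) (toList u))

inPair : List Bool → List Bool → Bool
inPair x w with ≡-dec _≟ᵇ_ x w | ≡-dec _≟ᵇ_ x (negL w)
... | yes _ | _ = true
... | no _ | yes _ = true
... | no _ | no _ = false

φ : ∀ {m n} → Vec Bool (suc m) → ℕ → Word n → Word n
φ {m} {n} a i u =
  if (i + m ≤ᵇ n) ∧ inPair (sub u i (i + m)) (toList a)
  then tabulate (λ (p : Fin n) →
         let k = suc (toℕ p) in
         if (i ≤ᵇ k) ∧ (k ≤ᵇ i + m) then not (lookup u p) else lookup u p)
  else u

-- φ_i changes only the letters on its line, and it never changes whether it fires
-- itself, since negating a word of {a, ¬a} gives a word of {a, ¬a}. Hence φ_i and φ_j
-- commute on u as soon as neither changes whether the other fires: both composites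
-- then negate the lines of those of the two maps that fire on u. For disjoint lines
-- this is automatic. For overlapping lines, some word makes both maps fire exactly
-- when a_[1,m+1-Δ] ∈ {a_[Δ+1,m+1], ¬a_[Δ+1,m+1]}. If there is no such word, whether a
-- map fires is again preserved. If u is such a word, φ_j u keeps the first letter of
-- the line of φ_i but negates its last one, so φ_i does not fire on φ_j u, and the two
-- composites differ at position i.
module Submission where

open import Defs
open import Data.Bool using (Bool; true; false; not; _∧_; _xor_; if_then_else_)
open import Data.Bool.Properties
  using (not-involutive; not-¬; ¬-not; T-≡; ⇔→≡; ∧-zeroʳ; xor-assoc; xor-comm; xor-same;
         not-distribˡ-xor)
  renaming (_≟_ to _≟ᵇ_)
open import Data.Nat using (ℕ; zero; suc; _+_; _∸_; _≤_; _<_; _≤ᵇ_; z≤n; s≤s; z<s; _≤?_)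
open import Data.Nat.Properties
open import Data.List using (List; []; _∷_; take; drop; length)
open import Data.List.Properties using (≡-dec; take-map; take-all; length-drop; length-map)
open import Data.Vec using (Vec; []; _∷_; toList; tabulate; lookup)
open import Data.Vec.Properties using (length-toList)
open import Data.Fin using (Fin; toℕ; fromℕ<)
open import Data.Fin.Properties using (toℕ-fromℕ<)
open import Data.Product using (_×_; _,_; ∃-syntax)
open import Data.Sum using (_⊎_; inj₁; inj₂; [_,_])
open import Data.Empty using (⊥; ⊥-elim)
open import Function using (_∘_)
open import Function.Bundles using (_⇔_; mk⇔; Equivalence)
open import Function.Properties.Equivalence using () renaming (trans to ⇔-trans; sym to ⇔-sym)
open import Relation.Nullary using (¬_; yes; no)
open import Relation.Binary.PropositionalEquality
  using (_≡_; _≢_; refl; sym; trans; cong; cong₂; subst; module ≡-Reasoning)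
open ≡-Reasoning

open Equivalence using (to; from)

≤⇒≤ᵇ≡true : ∀ {m n} → m ≤ n → (m ≤ᵇ n) ≡ true
≤⇒≤ᵇ≡true = to T-≡ ∘ ≤⇒≤ᵇ

>⇒≤ᵇ≡false : ∀ {m n} → n < m → (m ≤ᵇ n) ≡ false
>⇒≤ᵇ≡false {m} {n} n<m = ¬-not λ m≤ᵇn → <⇒≱ n<m (≤ᵇ⇒≤ m n (from T-≡ m≤ᵇn))

<∸⇒+≤ : ∀ {k d m} → d ≤ m → k < suc m ∸ d → d + k ≤ m
<∸⇒+≤ {k} {d} {m} d≤m k<m+1-d =
  subst (_≤ m) (+-comm k d) (≤-pred (m≤o∸n⇒m+n≤o (suc k) (m≤n⇒m≤1+n d≤m) k<m+1-d))

+≤⇒<∸ : ∀ {k d m} → d + k ≤ m → k < suc m ∸ d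
+≤⇒<∸ {k} {d} {m} d+k≤m = m+n≤o⇒m≤o∸n (suc k) (s≤s (subst (_≤ m) (+-comm d k) d+k≤m))

≤∸⇒+≤ : ∀ {k m n} → 0 < k → k ≤ n ∸ m → k + m ≤ n
≤∸⇒+≤ {k} 0<k k≤n∸m = m≤o∸n⇒m+n≤o k m≤n k≤n∸m
  where
  m≤n = <⇒≤ (m∸n≢0⇒n<m λ n∸m≡0 → <⇒≱ 0<k (subst (k ≤_) n∸m≡0 k≤n∸m))

xor-involutive : ∀ x y → x xor (x xor y) ≡ y
xor-involutive x y = trans (sym (xor-assoc x x y)) (cong (_xor y) (xor-same x))

xor-swap : ∀ x y z → x xor (y xor z) ≡ y xor (x xor z)
xor-swap x y z =
  trans (sym (xor-assoc x y z)) (trans (cong (_xor z) (xor-comm x y)) (xor-assoc y x z))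

xor-cancelʳ : ∀ {x y} z → x xor z ≡ y xor z → x ≡ y
xor-cancelʳ {false} {false} _     _  = refl
xor-cancelʳ {true}  {true}  _     _  = refl
xor-cancelʳ {false} {true}  false ()
xor-cancelʳ {false} {true}  true  ()
xor-cancelʳ {true}  {false} false ()
xor-cancelʳ {true}  {false} true  ()

infixl 9 _!_

-- Total indexing: positions past the end read as false.
_!_ : List Bool → ℕ → Bool
[]       ! _     = false
(x ∷ _)  ! zero  = x
(_ ∷ xs) ! suc k = xs ! k

!-take : ∀ {l k} xs → k < l → take l xs ! k ≡ xs ! k
!-take {suc l}         []       _           = refl
!-take {suc l} {zero}  (x ∷ xs) _           = refl
!-take {suc l} {suc k} (x ∷ xs) (s≤s k<l) = !-take xs k<l

!-drop : ∀ d xs k → drop d xs ! k ≡ xs ! (d + k)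
!-drop zero    xs       k = refl
!-drop (suc d) []       k = refl
!-drop (suc d) (x ∷ xs) k = !-drop d xs k

!-negL : ∀ {k} xs → k < length xs → negL xs ! k ≡ not (xs ! k)
!-negL {zero}  (x ∷ xs) _           = refl
!-negL {suc k} (x ∷ xs) (s≤s k<len) = !-negL xs k<len

take-≡⇔ : ∀ l xs ys → l ≤ length xs → l ≤ length ys →
          take l xs ≡ take l ys ⇔ (∀ k → k < l → xs ! k ≡ ys ! k)
take-≡⇔ l xs ys l≤xs l≤ys = mk⇔ pointwise (ext l xs ys l≤xs l≤ys)
  where
  pointwise : take l xs ≡ take l ys → ∀ k → k < l → xs ! k ≡ ys ! k
  pointwise eq k k<l = trans (sym (!-take xs k<l)) (trans (cong (_! k) eq) (!-take ys k<l))

  ext : ∀ l xs ys → l ≤ length xs → l ≤ length ys →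
        (∀ k → k < l → xs ! k ≡ ys ! k) → take l xs ≡ take l ys
  ext zero    _        _        _           _           _  = refl
  ext (suc l) (x ∷ xs) (y ∷ ys) (s≤s l≤xs) (s≤s l≤ys) eq =
    cong₂ _∷_ (eq 0 z<s) (ext l xs ys l≤xs l≤ys λ k → eq (suc k) ∘ s≤s)

Agree : ℕ → Bool → List Bool → List Bool → Set
Agree l b xs ys = ∀ k → k < l → xs ! k ≡ b xor ys ! k

take-≡-or-negL⇔Agree : ∀ l xs ys → l ≤ length xs → l ≤ length ys →
  (take l xs ≡ take l ys ⊎ take l xs ≡ negL (take l ys)) ⇔ (∃[ b ] Agree l b xs ys)
take-≡-or-negL⇔Agree l xs ys l≤xs l≤ys = mk⇔ agree match
  where
  l≤¬ys : l ≤ length (negL ys)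
  l≤¬ys = subst (l ≤_) (sym (length-map not ys)) l≤ys

  agreeNeg⇔ : take l xs ≡ negL (take l ys) ⇔ Agree l true xs ys
  agreeNeg⇔ = ⇔-trans
    (mk⇔ (λ eq → trans eq (sym (take-map l ys))) (λ eq → trans eq (take-map l ys)))
    (⇔-trans (take-≡⇔ l xs (negL ys) l≤xs l≤¬ys)
      (mk⇔ (λ eq k k<l → trans (eq k k<l) (!-negL ys (<-≤-trans k<l l≤ys)))
           (λ eq k k<l → trans (eq k k<l) (sym (!-negL ys (<-≤-trans k<l l≤ys))))))

  agree : take l xs ≡ take l ys ⊎ take l xs ≡ negL (take l ys) → ∃[ b ] Agree l b xs ys
  agree (inj₁ eq) = false , to (take-≡⇔ l xs ys l≤xs l≤ys) eq
  agree (inj₂ eq) = true , to agreeNeg⇔ eq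

  match : ∃[ b ] Agree l b xs ys → take l xs ≡ take l ys ⊎ take l xs ≡ negL (take l ys)
  match (false , ag) = inj₁ (from (take-≡⇔ l xs ys l≤xs l≤ys) ag)
  match (true  , ag) = inj₂ (from agreeNeg⇔ ag)

negL-involutive : ∀ xs → negL (negL xs) ≡ xs
negL-involutive []       = refl
negL-involutive (x ∷ xs) = cong₂ _∷_ (not-involutive x) (negL-involutive xs)

inPair≡true⇔ : ∀ x w → inPair x w ≡ true ⇔ (x ≡ w ⊎ x ≡ negL w)
inPair≡true⇔ x w with ≡-dec _≟ᵇ_ x w | ≡-dec _≟ᵇ_ x (negL w)
... | yes x≡w | _        = mk⇔ (λ _ → inj₁ x≡w) (λ _ → refl)
... | no _    | yes x≡¬w = mk⇔ (λ _ → inj₂ x≡¬w) (λ _ → refl)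
... | no x≢w  | no x≢¬w  = mk⇔ (λ ()) (⊥-elim ∘ [ x≢w , x≢¬w ])

inPair-negL : ∀ x w → inPair (negL x) w ≡ inPair x w
inPair-negL x w =
  ⇔→≡ (⇔-trans (inPair≡true⇔ (negL x) w) (⇔-trans swap⇔ (⇔-sym (inPair≡true⇔ x w))))
  where
  swap : ∀ {y} → y ≡ w ⊎ y ≡ negL w → negL y ≡ w ⊎ negL y ≡ negL w
  swap (inj₁ eq) = inj₂ (cong negL eq)
  swap (inj₂ eq) = inj₁ (trans (cong negL eq) (negL-involutive w))

  swap⇔ : (negL x ≡ w ⊎ negL x ≡ negL w) ⇔ (x ≡ w ⊎ x ≡ negL w)
  swap⇔ = mk⇔ (subst (λ y → y ≡ w ⊎ y ≡ negL w) (negL-involutive x) ∘ swap) swap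

letter : ∀ {n} → Word n → ℕ → Bool
letter u k = toList u ! k

letter-lookup : ∀ {n} (u : Word n) (f : Fin n) → letter u (toℕ f) ≡ lookup u f
letter-lookup (x ∷ u) Fin.zero    = refl
letter-lookup (x ∷ u) (Fin.suc f) = letter-lookup u f

letter-tabulate : ∀ {n} (g : Fin n → Bool) (f : Fin n) → letter (tabulate g) (toℕ f) ≡ g f
letter-tabulate g Fin.zero    = refl
letter-tabulate g (Fin.suc f) = letter-tabulate (g ∘ Fin.suc) f

letter-tabulate-toℕ : ∀ {n k} (g : ℕ → Bool) → k < n →
                      letter (tabulate {n = n} (g ∘ toℕ)) k ≡ g k
letter-tabulate-toℕ {n} g k<n = subst (λ k → letter (tabulate {n = n} (g ∘ toℕ)) k ≡ g k)
                                      (toℕ-fromℕ< k<n) (letter-tabulate (g ∘ toℕ) (fromℕ< k<n))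

letter-ext : ∀ {n} (u v : Word n) → (∀ k → k < n → letter u k ≡ letter v k) → u ≡ v
letter-ext []      []      _  = refl
letter-ext (x ∷ u) (y ∷ v) eq = cong₂ _∷_ (eq 0 z<s) (letter-ext u v λ k → eq (suc k) ∘ s≤s)

module SimpleMaps {m n : ℕ} (a : Vec Bool (suc m)) where

  key : List Bool
  key = toList a

  fires : Word n → ℕ → Bool
  fires u i = (i + m ≤ᵇ n) ∧ inPair (sub u i (i + m)) key

  -- Map indices i are 1-based as in the paper, letter positions k are 0-based.
  inLine : ℕ → ℕ → Bool
  inLine i k = (i ≤ᵇ suc k) ∧ (suc k ≤ᵇ i + m)

  Commute : ℕ → ℕ → Set
  Commute i j = ∀ (u : Word n) → φ a i (φ a j u) ≡ φ a j (φ a i u)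

  NeverBothFire : ℕ → ℕ → Set
  NeverBothFire i j = ∀ v → fires v i ≡ true → fires v j ≡ true → ⊥

  φ-unfired : ∀ u i → fires u i ≡ false → φ a i u ≡ u
  φ-unfired u i unfired = cong (if_then _ else u) unfired

  φ-letter-toℕ : ∀ u i (f : Fin n) →
                 letter (φ a i u) (toℕ f) ≡ (fires u i ∧ inLine i (toℕ f)) xor letter u (toℕ f)
  φ-letter-toℕ u i f with fires u i
  ... | false = refl
  ... | true rewrite letter-tabulate (λ p → if inLine i (toℕ p) then not (lookup u p) else lookup u p) f
                   | letter-lookup u f
                   with inLine i (toℕ f)
  ...   | false = refl
  ...   | true  = refl

  φ-letter : ∀ u i {k} → k < n → letter (φ a i u) k ≡ (fires u i ∧ inLine i k) xor letter u k
  φ-letter u i k<n = subst (λ k → letter (φ a i u) k ≡ (fires u i ∧ inLine i k) xor letter u k)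
                           (toℕ-fromℕ< k<n) (φ-letter-toℕ u i (fromℕ< k<n))

  φ-letter-outside : ∀ u i {k} → k < n → inLine i k ≡ false → letter (φ a i u) k ≡ letter u k
  φ-letter-outside u i k<n outside rewrite φ-letter u i k<n | outside | ∧-zeroʳ (fires u i) = refl

  φ-letter-inside : ∀ u i {k} → k < n → fires u i ≡ true → inLine i k ≡ true →
                    letter (φ a i u) k ≡ not (letter u k)
  φ-letter-inside u i k<n fired inside rewrite φ-letter u i k<n | fired | inside = refl

  φ-comm-if-firing-kept : ∀ u i j →
    fires (φ a j u) i ≡ fires u i → fires (φ a i u) j ≡ fires u j →
    φ a i (φ a j u) ≡ φ a j (φ a i u)
  φ-comm-if-firing-kept u i j kept-i kept-j = letter-ext _ _ λ k k<n → begin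
    letter (φ a i (φ a j u)) k
      ≡⟨ φ-letter (φ a j u) i k<n ⟩
    (fires (φ a j u) i ∧ inLine i k) xor letter (φ a j u) k
      ≡⟨ cong₂ (λ b x → (b ∧ inLine i k) xor x) kept-i (φ-letter u j k<n) ⟩
    (fires u i ∧ inLine i k) xor ((fires u j ∧ inLine j k) xor letter u k)
      ≡⟨ xor-swap (fires u i ∧ inLine i k) (fires u j ∧ inLine j k) (letter u k) ⟩
    (fires u j ∧ inLine j k) xor ((fires u i ∧ inLine i k) xor letter u k)
      ≡˘⟨ cong₂ (λ b x → (b ∧ inLine j k) xor x) kept-j (φ-letter u i k<n) ⟩
    (fires (φ a i u) j ∧ inLine j k) xor letter (φ a i u) k
      ≡˘⟨ φ-letter (φ a i u) j k<n ⟩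
    letter (φ a j (φ a i u)) k ∎

  inLine-within : ∀ {p k} → p ≤ k → k ≤ p + m → inLine (suc p) k ≡ true
  inLine-within p≤k k≤p+m =
    cong₂ _∧_ (≤⇒≤ᵇ≡true (s≤s p≤k)) (≤⇒≤ᵇ≡true (s≤s k≤p+m))

  inLine-before : ∀ {p k} → k < p → inLine (suc p) k ≡ false
  inLine-before {p} {k} k<p = cong (_∧ (suc k ≤ᵇ suc p + m)) (>⇒≤ᵇ≡false (s≤s k<p))

  inLine-after : ∀ {p k} → p + m < k → inLine (suc p) k ≡ false
  inLine-after {p} {k} p+m<k =
    trans (cong ((suc p ≤ᵇ suc k) ∧_) (>⇒≤ᵇ≡false (s≤s p+m<k))) (∧-zeroʳ _)

  line-bound : ∀ {p k} → suc p + m ≤ n → k ≤ m → p + k < n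
  line-bound {p} fits k≤m = <-≤-trans (s≤s (+-monoʳ-≤ p k≤m)) fits

  shifted-line-fits : ∀ {p d} → suc (p + d) + m ≤ n → suc p + m ≤ n
  shifted-line-fits {p} {d} fits = ≤-trans (s≤s (+-monoˡ-≤ m (m≤m+n p d))) fits

  line-fits-drop : ∀ {p} (u : Word n) → suc p + m ≤ n → suc m ≤ length (drop p (toList u))
  line-fits-drop {p} u fits rewrite length-drop p (toList u) | length-toList u =
    m+n≤o⇒m≤o∸n (suc m) (subst (_≤ n) (cong suc (+-comm p m)) fits)

  window : Word n → ℕ → List Bool
  window u p = take (suc m) (drop p (toList u))

  fires-window : ∀ u p → suc p + m ≤ n → fires u (suc p) ≡ inPair (window u p) key
  fires-window u p fits = cong₂ _∧_ (≤⇒≤ᵇ≡true fits)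
    (cong (λ l → inPair (take l (drop p (toList u))) key)
          (trans (cong (_∸ p) (sym (+-suc p m))) (m+n∸m≡n p (suc m))))

  window-from-letters : ∀ v p ys → suc p + m ≤ n → suc m ≤ length ys →
    (∀ k → k ≤ m → letter v (p + k) ≡ ys ! k) → window v p ≡ take (suc m) ys
  window-from-letters v p ys fits m<ys eq =
    from (take-≡⇔ (suc m) _ ys (line-fits-drop v fits) m<ys)
         λ k k<1+m → trans (!-drop p (toList v) k) (eq k (≤-pred k<1+m))

  fires-local : ∀ u v p → suc p + m ≤ n →
    (∀ k → k ≤ m → letter v (p + k) ≡ letter u (p + k)) → fires v (suc p) ≡ fires u (suc p)
  fires-local u v p fits eq = begin
    fires v (suc p)           ≡⟨ fires-window v p fits ⟩
    inPair (window v p) key   ≡⟨ cong (λ w → inPair w key) window-eq ⟩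
    inPair (window u p) key   ≡˘⟨ fires-window u p fits ⟩
    fires u (suc p)           ∎
    where
    window-eq : window v p ≡ window u p
    window-eq = window-from-letters v p _ fits (line-fits-drop u fits)
                  λ k k≤m → trans (eq k k≤m) (sym (!-drop p (toList u) k))

  φ-keeps-firing : ∀ u p → suc p + m ≤ n → fires u (suc p) ≡ true →
                   fires (φ a (suc p) u) (suc p) ≡ true
  φ-keeps-firing u p fits fired = begin
    fires (φ a (suc p) u) (suc p)        ≡⟨ fires-window _ p fits ⟩
    inPair (window (φ a (suc p) u) p) key ≡⟨ cong (λ w → inPair w key) window-negated ⟩
    inPair (negL (window u p)) key       ≡⟨ inPair-negL _ key ⟩
    inPair (window u p) key              ≡˘⟨ fires-window u p fits ⟩
    fires u (suc p)                      ≡⟨ fired ⟩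
    true                                 ∎
    where
    xs = drop p (toList u)

    m<xs : suc m ≤ length xs
    m<xs = line-fits-drop u fits

    negated : ∀ k → k ≤ m → letter (φ a (suc p) u) (p + k) ≡ negL xs ! k
    negated k k≤m = begin
      letter (φ a (suc p) u) (p + k)  ≡⟨ φ-letter-inside u (suc p) (line-bound fits k≤m) fired
                                           (inLine-within (m≤m+n p k) (+-monoʳ-≤ p k≤m)) ⟩
      not (letter u (p + k))          ≡˘⟨ cong not (!-drop p (toList u) k) ⟩
      not (xs ! k)                    ≡˘⟨ !-negL xs (<-≤-trans (s≤s k≤m) m<xs) ⟩
      negL xs ! k                     ∎

    window-negated : window (φ a (suc p) u) p ≡ negL (window u p)
    window-negated = trans (window-from-letters _ p (negL xs) fits m<¬xs negated) (take-map (suc m) xs)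
      where
      m<¬xs = subst (suc m ≤_) (sym (length-map not xs)) m<xs

  disjoint⇒commute : ∀ p d → m < d → suc (p + d) + m ≤ n → Commute (suc p) (suc (p + d))
  disjoint⇒commute p d m<d fits u = φ-comm-if-firing-kept u (suc p) (suc (p + d))
    (fires-local u _ p fits-p λ k k≤m → φ-letter-outside u (suc (p + d)) (line-bound fits-p k≤m)
      (inLine-before (+-monoʳ-< p (≤-<-trans k≤m m<d))))
    (fires-local u _ (p + d) fits λ k k≤m → φ-letter-outside u (suc p) (line-bound fits k≤m)
      (inLine-after (≤-trans (+-monoʳ-< p m<d) (m≤m+n (p + d) k))))
    where
    fits-p = shifted-line-fits fits

  fires-φ-exclusive : ∀ u i q → suc q + m ≤ n → NeverBothFire i (suc q) →
                      fires (φ a (suc q) u) i ≡ fires u i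
  fires-φ-exclusive u i q fits exclusive = by-firing-of-q (fires u (suc q)) refl
    where
    by-firing-of-q : ∀ b → fires u (suc q) ≡ b → fires (φ a (suc q) u) i ≡ fires u i
    by-firing-of-q false unfired = cong (λ v → fires v i) (φ-unfired u (suc q) unfired)
    by-firing-of-q true  fired   =
      trans (¬-not λ fires-i → exclusive (φ a (suc q) u) fires-i (φ-keeps-firing u q fits fired))
            (sym (¬-not λ fires-i → exclusive u fires-i fired))

  exclusive⇒commute : ∀ p q → suc p + m ≤ n → suc q + m ≤ n →
                      NeverBothFire (suc p) (suc q) → Commute (suc p) (suc q)
  exclusive⇒commute p q fits-p fits-q exclusive u = φ-comm-if-firing-kept u (suc p) (suc q)
    (fires-φ-exclusive u (suc p) q fits-q exclusive)
    (fires-φ-exclusive u (suc q) p fits-p λ v fires-q fires-p → exclusive v fires-p fires-q)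

  -- The line of φ_(1+p) reads a in u (b = false) or ¬a (b = true).
  Reads : Word n → ℕ → Bool → Set
  Reads u p b = ∀ k → k ≤ m → letter u (p + k) ≡ b xor key ! k

  fires⇔Reads : ∀ u p → suc p + m ≤ n → fires u (suc p) ≡ true ⇔ (∃[ b ] Reads u p b)
  fires⇔Reads u p fits = ⇔-trans fires⇔match (⇔-trans match⇔Agree Agree⇔Reads)
    where
    xs = drop p (toList u)

    fires⇔match : fires u (suc p) ≡ true ⇔ (window u p ≡ key ⊎ window u p ≡ negL key)
    fires⇔match = subst (λ b → b ≡ true ⇔ (window u p ≡ key ⊎ window u p ≡ negL key))
                        (sym (fires-window u p fits)) (inPair≡true⇔ (window u p) key)

    match⇔Agree : (window u p ≡ key ⊎ window u p ≡ negL key) ⇔ (∃[ b ] Agree (suc m) b xs key)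
    match⇔Agree =
      subst (λ w → (window u p ≡ w ⊎ window u p ≡ negL w) ⇔ (∃[ b ] Agree (suc m) b xs key))
        (take-all (suc m) key (≤-reflexive (length-toList a)))
        (take-≡-or-negL⇔Agree (suc m) xs key (line-fits-drop u fits)
          (≤-reflexive (sym (length-toList a))))

    Agree⇔Reads : (∃[ b ] Agree (suc m) b xs key) ⇔ (∃[ b ] Reads u p b)
    Agree⇔Reads = mk⇔
      (λ (b , ag) → b , λ k k≤m → trans (sym (!-drop p (toList u) k)) (ag k (s≤s k≤m)))
      (λ (b , rd) → b , λ k k<1+m → trans (!-drop p (toList u) k) (rd k (≤-pred k<1+m)))

  ¬Reads-after-partial-flip : ∀ {u v p b c k l} → k ≤ m → l ≤ m →
    letter v (p + k) ≡ letter u (p + k) → letter v (p + l) ≡ not (letter u (p + l)) →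
    Reads u p b → ¬ Reads v p c
  ¬Reads-after-partial-flip {u} {v} {p} {b} {c} {k} {l} k≤m l≤m kept flipped reads-u reads-v =
    not-¬ c≡b c≡¬b
    where
    c≡b : c ≡ b
    c≡b = xor-cancelʳ (key ! k) (trans (sym (reads-v k k≤m)) (trans kept (reads-u k k≤m)))

    c≡¬b : c ≡ not b
    c≡¬b = xor-cancelʳ (key ! l) (begin
      c xor key ! l           ≡˘⟨ reads-v l l≤m ⟩
      letter v (p + l)        ≡⟨ flipped ⟩
      not (letter u (p + l))  ≡⟨ cong not (reads-u l l≤m) ⟩
      not (b xor key ! l)     ≡⟨ not-distribˡ-xor b _ ⟩
      not b xor key ! l       ∎)

  -- Where the lines of φ_i and φ_(i+d) overlap, the later one reads front d and the
  -- earlier one back d, in the case that both read a.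
  front back : ℕ → List Bool
  front d = sub a 1 (suc m ∸ d)
  back  d = sub a (suc d) (suc m)

  SelfOverlap : ℕ → Bool → Set
  SelfOverlap d c = Agree (suc m ∸ d) c key (drop d key)

  SelfOverlap⇔ : ∀ d → (front d ≡ back d ⊎ front d ≡ negL (back d)) ⇔ (∃[ c ] SelfOverlap d c)
  SelfOverlap⇔ d = take-≡-or-negL⇔Agree (suc m ∸ d) key (drop d key)
    (subst (suc m ∸ d ≤_) (sym (length-toList a)) (m∸n≤m (suc m) d))
    (≤-reflexive (sym (trans (length-drop d key) (cong (_∸ d) (length-toList a)))))

  Reads-both⇒SelfOverlap : ∀ {u p d b c} → d ≤ m → Reads u p b → Reads u (p + d) c →
                           SelfOverlap d (c xor b)
  Reads-both⇒SelfOverlap {u} {p} {d} {b} {c} d≤m reads-p reads-q k k<m+1-d = begin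
    key ! k                       ≡˘⟨ xor-involutive c _ ⟩
    c xor (c xor key ! k)         ≡˘⟨ cong (c xor_) (reads-q k (≤-trans (m≤n+m k d) d+k≤m)) ⟩
    c xor letter u (p + d + k)    ≡⟨ cong (λ x → c xor letter u x) (+-assoc p d k) ⟩
    c xor letter u (p + (d + k))  ≡⟨ cong (c xor_) (reads-p (d + k) d+k≤m) ⟩
    c xor (b xor key ! (d + k))   ≡˘⟨ xor-assoc c b _ ⟩
    (c xor b) xor key ! (d + k)   ≡˘⟨ cong ((c xor b) xor_) (!-drop d key k) ⟩
    (c xor b) xor drop d key ! k  ∎
    where
    d+k≤m = <∸⇒+≤ d≤m k<m+1-d

  fire-both⇒SelfOverlap : ∀ {u p d} → d ≤ m → suc (p + d) + m ≤ n →
    fires u (suc p) ≡ true → fires u (suc (p + d)) ≡ true → ∃[ c ] SelfOverlap d c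
  fire-both⇒SelfOverlap {u} {p} {d} d≤m fits fires-p fires-q
    with to (fires⇔Reads u p (shifted-line-fits fits)) fires-p | to (fires⇔Reads u (p + d) fits) fires-q
  ... | b , reads-p | c , reads-q =
    c xor b , Reads-both⇒SelfOverlap {u} {p} {d} {b} {c} d≤m reads-p reads-q

  -- The word reads a on the line of φ_(1+p) and continues as c xor a along the line of
  -- φ_(1+p+d); the self-overlap makes the two readings agree where the lines meet.
  SelfOverlap⇒fire-both : ∀ p d c → d ≤ m → suc (p + d) + m ≤ n → SelfOverlap d c →
    ∃[ u ] (fires u (suc p) ≡ true × fires u (suc (p + d)) ≡ true)
  SelfOverlap⇒fire-both p d c d≤m fits self-overlap =
    u , from (fires⇔Reads u p fits-p) (false , reads-p)
      , from (fires⇔Reads u (p + d) fits) (c , reads-q)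
    where
    fits-p = shifted-line-fits fits

    g : ℕ → Bool
    g k = if k ≤ᵇ p + m then key ! (k ∸ p) else c xor key ! (k ∸ (p + d))

    g-within : ∀ {k} → k ≤ p + m → g k ≡ key ! (k ∸ p)
    g-within k≤p+m rewrite ≤⇒≤ᵇ≡true k≤p+m = refl

    g-beyond : ∀ {k} → p + m < k → g k ≡ c xor key ! (k ∸ (p + d))
    g-beyond p+m<k rewrite >⇒≤ᵇ≡false p+m<k = refl

    u : Word n
    u = tabulate (g ∘ toℕ)

    reads-p : Reads u p false
    reads-p k k≤m = begin
      letter u (p + k)   ≡⟨ letter-tabulate-toℕ g (line-bound fits-p k≤m) ⟩
      g (p + k)          ≡⟨ g-within (+-monoʳ-≤ p k≤m) ⟩
      key ! (p + k ∸ p)  ≡⟨ cong (key !_) (m+n∸m≡n p k) ⟩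
      key ! k            ∎

    reads-q : Reads u (p + d) c
    reads-q k k≤m with d + k ≤? m
    ... | yes d+k≤m = begin
      letter u (p + d + k)      ≡⟨ letter-tabulate-toℕ g (line-bound fits k≤m) ⟩
      g (p + d + k)             ≡⟨ cong g (+-assoc p d k) ⟩
      g (p + (d + k))           ≡⟨ g-within (+-monoʳ-≤ p d+k≤m) ⟩
      key ! (p + (d + k) ∸ p)   ≡⟨ cong (key !_) (m+n∸m≡n p (d + k)) ⟩
      key ! (d + k)             ≡˘⟨ !-drop d key k ⟩
      drop d key ! k            ≡˘⟨ xor-involutive c _ ⟩
      c xor (c xor drop d key ! k)
                                ≡˘⟨ cong (c xor_) (self-overlap k (+≤⇒<∸ d+k≤m)) ⟩
      c xor key ! k             ∎
    ... | no d+k≰m = begin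
      letter u (p + d + k)              ≡⟨ letter-tabulate-toℕ g (line-bound fits k≤m) ⟩
      g (p + d + k)                     ≡⟨ g-beyond beyond ⟩
      c xor key ! (p + d + k ∸ (p + d)) ≡⟨ cong (λ x → c xor key ! x) (m+n∸m≡n (p + d) k) ⟩
      c xor key ! k                     ∎
      where
      beyond : p + m < p + d + k
      beyond = subst (p + m <_) (sym (+-assoc p d k)) (+-monoʳ-< p (≰⇒> d+k≰m))

  fire-both⇒¬commute : ∀ {u p d} → 1 ≤ d → d ≤ m → suc (p + d) + m ≤ n →
    fires u (suc p) ≡ true → fires u (suc (p + d)) ≡ true →
    φ a (suc p) (φ a (suc (p + d)) u) ≢ φ a (suc (p + d)) (φ a (suc p) u)
  fire-both⇒¬commute {u} {p} {d} 1≤d d≤m fits fires-p fires-q commutes =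
    not-¬ refl (begin
      letter u (p + 0)
        ≡˘⟨ first-kept u ⟩
      letter v (p + 0)
        ≡˘⟨ cong (λ w → letter w (p + 0)) (φ-unfired v (suc p) v-unfired) ⟩
      letter (φ a (suc p) v) (p + 0)
        ≡⟨ cong (λ w → letter w (p + 0)) commutes ⟩
      letter (φ a (suc (p + d)) (φ a (suc p) u)) (p + 0)
        ≡⟨ first-kept (φ a (suc p) u) ⟩
      letter (φ a (suc p) u) (p + 0)
        ≡⟨ φ-letter-inside u (suc p) (line-bound fits-p z≤n) fires-p
             (inLine-within (m≤m+n p 0) (+-monoʳ-≤ p z≤n)) ⟩
      not (letter u (p + 0)) ∎)
    where
    fits-p = shifted-line-fits fits
    v = φ a (suc (p + d)) u

    first-kept : ∀ w → letter (φ a (suc (p + d)) w) (p + 0) ≡ letter w (p + 0)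
    first-kept w =
      φ-letter-outside w (suc (p + d)) (line-bound fits-p z≤n) (inLine-before (+-monoʳ-< p 1≤d))

    last-flipped : letter v (p + m) ≡ not (letter u (p + m))
    last-flipped = φ-letter-inside u (suc (p + d)) (line-bound fits-p ≤-refl) fires-q
                     (inLine-within (+-monoʳ-≤ p d≤m) (+-monoˡ-≤ m (m≤m+n p d)))

    v-unfired : fires v (suc p) ≡ false
    v-unfired = ¬-not λ fires-v →
      let b , reads-u = to (fires⇔Reads u p fits-p) fires-p
          c , reads-v = to (fires⇔Reads v p fits-p) fires-v
      in ¬Reads-after-partial-flip {u} {v} {p} {b} {c} z≤n ≤-refl
           (first-kept u) last-flipped reads-u reads-v

  CommutationCriterion : ℕ → Set
  CommutationCriterion d =
    (suc m ≤ d) ⊎ ((d ≤ m) × (¬ (front d ≡ back d) × ¬ (front d ≡ negL (back d))))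

  Commute⇔ : ∀ p d → 1 ≤ d → suc (p + d) + m ≤ n →
             Commute (suc p) (suc (p + d)) ⇔ CommutationCriterion d
  Commute⇔ p d 1≤d fits = mk⇔ necessary sufficient
    where
    no-self-overlap : d ≤ m → Commute (suc p) (suc (p + d)) → ¬ (∃[ c ] SelfOverlap d c)
    no-self-overlap d≤m commute (c , self-overlap)
      with SelfOverlap⇒fire-both p d c d≤m fits self-overlap
    ... | u , fires-p , fires-q = fire-both⇒¬commute 1≤d d≤m fits fires-p fires-q (commute u)

    necessary : Commute (suc p) (suc (p + d)) → CommutationCriterion d
    necessary commute with suc m ≤? d
    ... | yes m<d = inj₁ m<d
    ... | no m≮d  = inj₂ (d≤m , ¬match ∘ inj₁ , ¬match ∘ inj₂)
      where
      d≤m = ≮⇒≥ m≮d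
      ¬match = no-self-overlap d≤m commute ∘ to (SelfOverlap⇔ d)

    sufficient : CommutationCriterion d → Commute (suc p) (suc (p + d))
    sufficient (inj₁ m<d) = disjoint⇒commute p d m<d fits
    sufficient (inj₂ (d≤m , ¬match₁ , ¬match₂)) =
      exclusive⇒commute p (p + d) (shifted-line-fits fits) fits λ v fires-p fires-q →
        [ ¬match₁ , ¬match₂ ]
          (from (SelfOverlap⇔ d) (fire-both⇒SelfOverlap d≤m fits fires-p fires-q))

proposition3p3 : (m : ℕ) → 1 ≤ m → (a : Vec Bool (suc m)) → (n : ℕ) → 1 ≤ n →
    (i j : ℕ) → 1 ≤ i → i < j → j ≤ n ∸ m →
    ((∀ (u : Word n) → φ a i (φ a j u) ≡ φ a j (φ a i u)) ⇔
      ((suc m ≤ j ∸ i) ⊎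
       ((j ∸ i ≤ m) ×
        (¬ (sub a 1 (suc m ∸ (j ∸ i)) ≡ sub a (suc (j ∸ i)) (suc m)) ×
         ¬ (sub a 1 (suc m ∸ (j ∸ i)) ≡ negL (sub a (suc (j ∸ i)) (suc m)))))))
proposition3p3 m _ a n _ (suc p) j (s≤s z≤n) i<j j≤n∸m
  with j ∸ suc p | m+n≤o⇒m≤o∸n 1 i<j | m+[n∸m]≡n (<⇒≤ i<j)
... | d | 1≤d | refl = Commute⇔ p d 1≤d (≤∸⇒+≤ z<s j≤n∸m)
  where open SimpleMaps {m} {n} a
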